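{- Let $S$ be a ssyt with entries in $[n]$ and nonempty columns $S(1),\dots,S(c)$; let $p(i)$ be the number of boxes of $S(i)$ and $Y(i)$ the set of entries of $S(i)$. Let $w(c)=n\,(n-1)\cdots1$ be the longest permutation, let $\sigma(c)$ be the output of the maximal-lift procedure with inputs $p(c),Y(c),w(c)$, and for $i=c-1,\dots,1$ let $\sigma(i)$ be the output of the maximal-lift procedure with inputs $p(i),Y(i)$ and $w:=\sigma(i+1)$. Then $\sigma(1)$ equals the permutation $\tau$ produced from $S$ by the maximal-line procedure described in the context.
   Context: For a subset $E\subseteq[n]$, $\tilde e_k$ is its $k$-th smallest element; for $t$-element subsets, $E\le F$ means $\tilde e_k\le\tilde f_k$ for all $k$. Maximal-lift procedure with inputs $1\le p\le n$, a $p$-element $Y\subseteq[n]$, and $w\in\mathfrak S_n$ with $Y\le\{w_1,\dots,w_p\}$: for $1\le j\le p$, $\sigma_j$ is the maximum element of $Y\setminus\{\sigma_1,\dots,\sigma_{j-1}\}$ not exceeding $w_j$. For $j>p$, use sub-procedure $P$: given $t$-element $A,B$ with $B\le A$ and $\gamma\notin A$, put $A'=A\cup\{\gamma\}$, let $q$ be least ($1\le q\le t+1$) with $\tilde b_q\not\le\tilde a'_q$ ($\tilde b_{t+1}=\infty$), output $a'=\tilde a'_q$ and update $A,B$ to $A'$, $B\cup\{a'\}$. $\sigma_{p+1}$ is the output of $P$ with $A=\{w_1,\dots,w_p\}$, $B=Y$, $\gamma=w_{p+1}$; for $j>p+1$, $\sigma_j$ is the output of $P$ with the updated $A,B$ and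 $\gamma=w_j$. (The hypotheses needed at each stage of the iteration in the claim are satisfied.) Maximal-line procedure: for a nonempty ssyt $T$ with columns $T(1),\dots,T(m)$, let $v_m$ be the bottom entry of $T(m)$ and, for $i=m-1,\dots,1$, $v_i$ the largest entry of $T(i)$ that is $\le v_{i+1}$; set $w(T)=v_1$ and let $T'$ be obtained by deleting the boxes of $v_1,\dots,v_m$ and pushing the remaining boxes of each column up. With $p=p(1)$, put $S_1=S$, and for $1\le j\le p$, $\tau_j=w(S_j)$, $S_{j+1}=S_j'$; then $\tau_{p+1},\dots,\tau_n$ are the elements of $[n]\setminus\{\tau_1,\dots,\tau_p\}$ in decreasing order. -}

module Defs where

open import Data.Nat using (ℕ; zero; suc; _≤_; _<_; _≤ᵇ_; _≡ᵇ_)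
open import Data.Bool using (Bool; true; false; if_then_else_; _∧_; not; _∨_)
open import Data.List using (List; []; _∷_; length; map; downFrom; last; filterᵇ; null; reverse)
open import Data.List.Relation.Unary.All using (All)
open import Data.List.Relation.Unary.Linked using (Linked)
open import Data.Maybe using (Maybe; just; nothing; _>>=_)
open import Data.Product using (_×_; _,_)
open import Relation.Binary.PropositionalEquality using (_≢_)

-- Semistandard Young tableaux, stored as the list of columns
-- S(1),...,S(c), each column listed top to bottom.

data RowWeak : List ℕ → List ℕ → Set where
  rw-[] : ∀ {xs} → RowWeak xs []
  rw-∷  : ∀ {x y xs ys} → x ≤ y → RowWeak xs ys → RowWeak (x ∷ xs) (y ∷ ys)

record IsSSYT (n : ℕ) (S : List (List ℕ)) : Set where
  field
    entries-in-[n]  : All (All (λ x → 1 ≤ x × x ≤ n)) S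
    cols-nonempty   : All (λ col → col ≢ []) S
    cols-strict     : All (Linked _<_) S
    rows-weak       : Linked RowWeak S

insert : ℕ → List ℕ → List ℕ
insert x [] = x ∷ []
insert x (y ∷ ys) = if x ≤ᵇ y then x ∷ y ∷ ys else y ∷ insert x ys

sort : List ℕ → List ℕ
sort [] = []
sort (x ∷ xs) = insert x (sort xs)

elem : ℕ → List ℕ → Bool
elem x [] = false
elem x (y ∷ ys) = (x ≡ᵇ y) ∨ elem x ys

remove : ℕ → List ℕ → List ℕ
remove x [] = []
remove x (y ∷ ys) = if x ≡ᵇ y then ys else y ∷ remove x ys

leqSorted : List ℕ → List ℕ → Bool
leqSorted [] [] = true
leqSorted (e ∷ es) (f ∷ fs) = (e ≤ᵇ f) ∧ leqSorted es fs
leqSorted _ _ = false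

leqSet : List ℕ → List ℕ → Bool
leqSet E F = leqSorted (sort E) (sort F)

maxBelow : ℕ → List ℕ → Maybe ℕ
maxBelow b [] = nothing
maxBelow b (x ∷ xs) with maxBelow b xs
... | nothing = if x ≤ᵇ b then just x else nothing
... | just m  = if x ≤ᵇ b then (if m ≤ᵇ x then just x else just m) else just m

take : ℕ → List ℕ → List ℕ
take zero _ = []
take (suc k) [] = []
take (suc k) (x ∷ xs) = x ∷ take k xs

drop : ℕ → List ℕ → List ℕ
drop zero xs = xs
drop (suc k) [] = []
drop (suc k) (x ∷ xs) = drop k xs

-- Maximal-lift procedure.  Permutations in one-line notation
-- w = w₁ w₂ … wₙ as lists.  `nothing` signals that a step of the
-- procedure is undefined / its hypotheses fail.

-- first phase (j ≤ p): Yrem = Y \ {σ₁,…,σ_{j-1}}, ws = w_j … w_p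
liftFirst : List ℕ → List ℕ → Maybe (List ℕ)
liftFirst Yrem [] = just []
liftFirst Yrem (wj ∷ ws) =
  maxBelow wj Yrem >>= λ s →
  liftFirst (remove s Yrem) ws >>= λ rest → just (s ∷ rest)

-- least q with b̃_q ≰ ã'_q (b̃_{t+1} = ∞); returns ã'_q
firstFail : List ℕ → List ℕ → Maybe ℕ
firstFail bs [] = nothing
firstFail [] (a ∷ as) = just a
firstFail (b ∷ bs) (a ∷ as) = if b ≤ᵇ a then firstFail bs as else just a

procP : List ℕ → List ℕ → ℕ → Maybe (ℕ × List ℕ × List ℕ)
procP A B γ =
  if elem γ A ∨ not (leqSet B A) then nothing
  else (firstFail (sort B) (sort (γ ∷ A)) >>= λ a' →
        just (a' , (γ ∷ A) , (a' ∷ B)))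

-- second phase (j > p): iterate P with γ = w_j
liftSecond : List ℕ → List ℕ → List ℕ → Maybe (List ℕ)
liftSecond A B [] = just []
liftSecond A B (γ ∷ ws) =
  procP A B γ >>= λ { (a' , A' , B') →
  liftSecond A' B' ws >>= λ rest → just (a' ∷ rest) }

maxLift : ℕ → List ℕ → List ℕ → Maybe (List ℕ)
maxLift p Y w =
  if not (leqSet Y (take p w)) then nothing
  else (liftFirst Y (take p w) >>= λ σs →
        liftSecond (take p w) Y (drop p w) >>= λ σt →
        just (σs Data.List.++ σt))

longest : ℕ → List ℕ
longest n = map suc (downFrom n)

-- σ(1) from the iteration: σ(c) = maxLift p(c) Y(c) w₀,
-- σ(i) = maxLift p(i) Y(i) σ(i+1)
liftChain : ℕ → List (List ℕ) → Maybe (List ℕ)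
liftChain n [] = just (longest n)
liftChain n (col ∷ cols) = liftChain n cols >>= maxLift (length col) col

-- from the columns T(i),…,T(m): returns v_i and the columns with
-- the boxes of v_i,…,v_m deleted (entries pushed up)
lineStep : List (List ℕ) → Maybe (ℕ × List (List ℕ))
lineStep [] = nothing
lineStep (col ∷ []) = last col >>= λ v → just (v , remove v col ∷ [])
lineStep (col ∷ rest@(_ ∷ _)) =
  lineStep rest >>= λ { (v' , rest') →
  maxBelow v' col >>= λ v → just (v , remove v col ∷ rest') }

nonemptyCols : List (List ℕ) → List (List ℕ)
nonemptyCols = filterᵇ (λ col → not (null col))

wT : List (List ℕ) → Maybe (ℕ × List (List ℕ))
wT T = lineStep T >>= λ { (v , T') → just (v , nonemptyCols T') }

lineIter : ℕ → List (List ℕ) → Maybe (List ℕ)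
lineIter zero T = just []
lineIter (suc k) T =
  wT T >>= λ { (v , T') → lineIter k T' >>= λ rest → just (v ∷ rest) }

firstColLength : List (List ℕ) → ℕ
firstColLength [] = 0
firstColLength (col ∷ _) = length col

maxLine : ℕ → List (List ℕ) → Maybe (List ℕ)
maxLine n S =
  lineIter (firstColLength S) S >>= λ τs →
  just (τs Data.List.++ filterᵇ (λ x → not (elem x τs)) (longest n))

module Submission where

-- Induction over the columns from the right.  Suppose the maximal-line
-- procedure on S(i+1), …, S(c) emits a rearrangement t of S(i+1) and leaves
-- nothing behind, and σ(i+1) is t followed by the remaining values in
-- decreasing order.  Write E ≼ F when, for every x, F has at least as many
-- entries ≥ x as E; for sets this is the order E ≤ F of the paper.  Row
-- weakness gives S(i) ≼ (first p(i) letters of σ(i+1)).  Under this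
-- dominance the first phase of the maximal lift picks, for each letter w_j,
-- the largest remaining entry of S(i) not exceeding w_j, which is exactly the
-- box of S(i) on the next line of the line procedure, and the dominance
-- persists; the sub-procedure P then always outputs the largest value not yet
-- in B, so the second phase lists the remaining values in decreasing order.
-- Hence σ(i) has the same shape, with t the word emitted on S(i), …, S(c).

open import Data.Bool using (Bool; true; false; not)
open import Data.Empty using (⊥-elim)
open import Data.List using (List; []; _∷_; _++_; length; last; filter; filterᵇ)
open import Data.List.Properties
  using (length-++; length-filter; filter-++; filter-all; filter-none; filter-some; filter-accept; filter-reject)
open import Data.List.Membership.Propositional using (_∈_; _∉_)
open import Data.List.Membership.Propositional.Properties using (∈-++⁻; ∈-++⁺ˡ; ∈-++⁺ʳ)
open import Data.List.Relation.Binary.Permutation.Propositional as ↭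
  using (_↭_; prep; swap; ↭-refl; ↭-sym; ↭-trans; module PermutationReasoning)
open import Data.List.Relation.Binary.Permutation.Propositional.Properties
  using (↭-length; filter-↭; All-resp-↭; ∈-resp-↭; shift; ++⁺ʳ)
open import Data.List.Relation.Binary.Subset.Propositional using (_⊆_)
open import Data.List.Relation.Unary.All as All using (All; []; _∷_)
open import Data.List.Relation.Unary.All.Properties as Allₚ using (¬All⇒Any¬)
open import Data.List.Relation.Unary.AllPairs as AllPairs using (AllPairs; []; _∷_)
import Data.List.Relation.Unary.AllPairs.Properties as AllPairs
open import Data.List.Relation.Unary.Any as Any using (Any; here; there)
open import Data.List.Relation.Unary.Linked as Linked using (Linked; []; _∷_)
open import Data.List.Relation.Unary.Linked.Properties using (Linked⇒AllPairs)
open import Data.List.Relation.Unary.Unique.Propositional using (Unique)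
open import Data.List.Relation.Unary.Unique.Propositional.Properties using (Unique[x∷xs]⇒x∉xs)
open import Data.Maybe using (Maybe; just; nothing; _>>=_)
open import Data.Nat using (ℕ; zero; suc; _≤_; _<_; _>_; z≤n; s≤s; z<s; _≤ᵇ_; _≡ᵇ_; _≤?_; _≟_; _+_; _∸_)
open import Data.Nat.Properties
open import Data.List.Membership.DecPropositional _≟_ using (_∈?_)
open import Data.Product using (Σ; _×_; _,_; proj₁; proj₂; map₂)
open import Data.Sum as Sum using (_⊎_; inj₁; inj₂)
open import Function using (_∘_)
open import Relation.Nullary using (yes; no; proof; contradiction)
open import Relation.Nullary.Decidable using (dec-true; dec-false)
open import Relation.Nullary.Reflects using (Reflects; ofʸ; ofⁿ; det)
open import Relation.Binary.PropositionalEquality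

open import Defs

≤ᵇ-true : ∀ {m n} → m ≤ n → (m ≤ᵇ n) ≡ true
≤ᵇ-true {m} {n} = dec-true (m ≤? n)

≤ᵇ-false : ∀ {m n} → n < m → (m ≤ᵇ n) ≡ false
≤ᵇ-false {m} {n} n<m = dec-false (m ≤? n) (<⇒≱ n<m)

≡ᵇ-reflects-≡ : ∀ m n → Reflects (m ≡ n) (m ≡ᵇ n)
≡ᵇ-reflects-≡ m n = proof (m ≟ n)

-- Counting entries at or above a threshold

count≥ : ℕ → List ℕ → ℕ
count≥ x xs = length (filter (x ≤?_) xs)

count≥-accept : ∀ {x y} ys → x ≤ y → count≥ x (y ∷ ys) ≡ suc (count≥ x ys)
count≥-accept {x} ys x≤y = cong length (filter-accept (x ≤?_) {xs = ys} x≤y)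

count≥-reject : ∀ {x y} ys → y < x → count≥ x (y ∷ ys) ≡ count≥ x ys
count≥-reject {x} ys y<x = cong length (filter-reject (x ≤?_) {xs = ys} (<⇒≱ y<x))

count≥≤length : ∀ x xs → count≥ x xs ≤ length xs
count≥≤length x = length-filter (x ≤?_)

count≥-++ : ∀ x xs ys → count≥ x (xs ++ ys) ≡ count≥ x xs + count≥ x ys
count≥-++ x xs ys = trans (cong length (filter-++ (x ≤?_) xs ys)) (length-++ (filter (x ≤?_) xs))

count≥-↭ : ∀ x {xs ys} → xs ↭ ys → count≥ x xs ≡ count≥ x ys
count≥-↭ x xs↭ys = ↭-length (filter-↭ (x ≤?_) xs↭ys)

count≥-split : ∀ x xs ys {L} → xs ++ ys ↭ L → count≥ x xs + count≥ x ys ≡ count≥ x L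
count≥-split x xs ys split = trans (sym (count≥-++ x xs ys)) (count≥-↭ x split)

length-split : ∀ (xs ys : List ℕ) {L} → xs ++ ys ↭ L → length xs + length ys ≡ length L
length-split xs ys split = trans (sym (length-++ xs)) (↭-length split)

count≥-all : ∀ {x xs} → All (x ≤_) xs → count≥ x xs ≡ length xs
count≥-all {x} all = cong length (filter-all (x ≤?_) all)

count≥-none : ∀ {x xs} → All (_< x) xs → count≥ x xs ≡ 0
count≥-none {x} all = cong length (filter-none (x ≤?_) (All.map <⇒≱ all))

dec-head<⇒count≥≡0 : ∀ {x y ys} → AllPairs _>_ (y ∷ ys) → y < x → count≥ x (y ∷ ys) ≡ 0
dec-head<⇒count≥≡0 (y>ys ∷ _) y<x = count≥-none (y<x ∷ All.map (λ z<y → <-trans z<y y<x) y>ys)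

count≥<length⇒Any : ∀ x xs → count≥ x xs < length xs → Any (_< x) xs
count≥<length⇒Any x xs lt with All.all? (x ≤?_) xs
... | yes all = contradiction (count≥-all all) (<⇒≢ lt)
... | no ¬all = Any.map ≰⇒> (¬All⇒Any¬ (x ≤?_) xs ¬all)

count≥≡0⇒All : ∀ x xs → count≥ x xs ≡ 0 → All (_< x) xs
count≥≡0⇒All x xs none with All.all? (_<? x) xs
... | yes all = all
... | no ¬all = contradiction none (>⇒≢ (filter-some (x ≤?_) (Any.map ≮⇒≥ (¬All⇒Any¬ (_<? x) xs ¬all))))

count≥-∷ : ∀ x y ys → count≥ x ys ≤ count≥ x (y ∷ ys)
count≥-∷ x y ys with x ≤? y
... | yes x≤y = ≤-trans (n≤1+n _) (≤-reflexive (sym (count≥-accept ys x≤y)))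
... | no x≰y  = ≤-reflexive (sym (count≥-reject ys (≰⇒> x≰y)))

count≥-mono : ∀ {x z} ys → (∀ {y} → y ∈ ys → x ≤ y → z ≤ y) → count≥ x ys ≤ count≥ z ys
count≥-mono [] _ = z≤n
count≥-mono {x} {z} (y ∷ ys) x≤⇒z≤ with x ≤? y
... | yes x≤y rewrite count≥-accept ys x≤y | count≥-accept ys (x≤⇒z≤ (here refl) x≤y) =
  s≤s (count≥-mono ys (x≤⇒z≤ ∘ there))
... | no x≰y rewrite count≥-reject ys (≰⇒> x≰y) =
  ≤-trans (count≥-mono ys (x≤⇒z≤ ∘ there)) (count≥-∷ z y ys)

_≼_ : List ℕ → List ℕ → Set
E ≼ F = length E ≡ length F × (∀ x → count≥ x E ≤ count≥ x F)

≼-resp-↭ : ∀ {E E′ F F′} → E ↭ E′ → F ↭ F′ → E ≼ F → E′ ≼ F′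
≼-resp-↭ {E} {E′} {F} {F′} E↭E′ F↭F′ (len , cnt) =
  trans (sym (↭-length E↭E′)) (trans len (↭-length F↭F′)) ,
  λ x → subst₂ _≤_ (count≥-↭ x E↭E′) (count≥-↭ x F↭F′) (cnt x)

Sorted : List ℕ → Set
Sorted = AllPairs _≤_

insert-↭ : ∀ x xs → insert x xs ↭ x ∷ xs
insert-↭ x [] = ↭-refl
insert-↭ x (y ∷ ys) with x ≤ᵇ y
... | true  = ↭-refl
... | false = ↭-trans (prep y (insert-↭ x ys)) (swap y x ↭-refl)

sort-↭ : ∀ xs → sort xs ↭ xs
sort-↭ [] = ↭-refl
sort-↭ (x ∷ xs) = ↭-trans (insert-↭ x (sort xs)) (prep x (sort-↭ xs))

insert-sorted : ∀ x {xs} → Sorted xs → Sorted (insert x xs)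
insert-sorted x [] = [] ∷ []
insert-sorted x {y ∷ ys} (y≤ys ∷ sorted) with x ≤ᵇ y | ≤ᵇ-reflects-≤ x y
... | true  | ofʸ x≤y = (x≤y ∷ All.map (≤-trans x≤y) y≤ys) ∷ y≤ys ∷ sorted
... | false | ofⁿ x≰y =
  All-resp-↭ (↭-sym (insert-↭ x ys)) (≤-trans (n≤1+n y) (≰⇒> x≰y) ∷ y≤ys) ∷ insert-sorted x sorted

sort-sorted : ∀ xs → Sorted (sort xs)
sort-sorted [] = []
sort-sorted (x ∷ xs) = insert-sorted x (sort-sorted xs)

≼-head : ∀ {e f es fs} → Sorted (e ∷ es) → (e ∷ es) ≼ (f ∷ fs) → e ≤ f
≼-head {e} {f} {es} {fs} (e≤es ∷ _) (len , cnt) with e ≤? f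
... | yes e≤f = e≤f
... | no e≰f = contradiction (begin-strict
      length (e ∷ es)   ≡⟨ count≥-all (≤-refl ∷ e≤es) ⟨
      count≥ e (e ∷ es) ≤⟨ cnt e ⟩
      count≥ e (f ∷ fs) ≡⟨ count≥-reject fs (≰⇒> e≰f) ⟩
      count≥ e fs       ≤⟨ count≥≤length e fs ⟩
      length fs         <⟨ n<1+n _ ⟩
      length (f ∷ fs)   ≡⟨ len ⟨
      length (e ∷ es)   ∎) (<-irrefl refl)
  where open ≤-Reasoning

≼-tail : ∀ {e f es fs} → e ≤ f → Sorted (f ∷ fs) → (e ∷ es) ≼ (f ∷ fs) → es ≼ fs
≼-tail {e} {f} {es} {fs} e≤f (f≤fs ∷ _) (len , cnt) = suc-injective len , bound
  where
    open ≤-Reasoning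
    bound : ∀ x → count≥ x es ≤ count≥ x fs
    bound x with x ≤? f
    ... | yes x≤f = begin
      count≥ x es ≤⟨ count≥≤length x es ⟩
      length es   ≡⟨ suc-injective len ⟩
      length fs   ≡⟨ count≥-all (All.map (≤-trans x≤f) f≤fs) ⟨
      count≥ x fs ∎
    ... | no x≰f = begin
      count≥ x es       ≡⟨ count≥-reject es (≤-<-trans e≤f (≰⇒> x≰f)) ⟨
      count≥ x (e ∷ es) ≤⟨ cnt x ⟩
      count≥ x (f ∷ fs) ≡⟨ count≥-reject fs (≰⇒> x≰f) ⟩
      count≥ x fs       ∎

≼⇒leqSorted : ∀ {es fs} → Sorted es → Sorted fs → es ≼ fs → leqSorted es fs ≡ true
≼⇒leqSorted {[]}     {[]}     _ _ _ = refl
≼⇒leqSorted {[]}     {_ ∷ _}  _ _ (() , _)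
≼⇒leqSorted {_ ∷ _}  {[]}     _ _ (() , _)
≼⇒leqSorted {e ∷ es} {f ∷ fs} ses@(_ ∷ ses′) sfs@(_ ∷ sfs′) es≼fs
  rewrite ≤ᵇ-true (≼-head ses es≼fs) =
  ≼⇒leqSorted ses′ sfs′ (≼-tail (≼-head ses es≼fs) sfs es≼fs)

≼⇒leqSet : ∀ E F → E ≼ F → leqSet E F ≡ true
≼⇒leqSet E F E≼F =
  ≼⇒leqSorted (sort-sorted E) (sort-sorted F) (≼-resp-↭ (↭-sym (sort-↭ E)) (↭-sym (sort-↭ F)) E≼F)

Sorted-head< : ∀ {b bs x} → Sorted (b ∷ bs) → Any (_< x) (b ∷ bs) → b < x
Sorted-head< _           (here b<x) = b<x
Sorted-head< (b≤bs ∷ _) (there any) = All.lookupWith ≤-<-trans b≤bs any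

firstFail-head< : ∀ {a as b bs} → AllPairs _<_ (a ∷ as) → length as ≡ length (b ∷ bs) →
  count≥ (suc a) (b ∷ bs) ≡ count≥ (suc a) (a ∷ as) → a < b
firstFail-head< {a} {as} {b} {bs} (a<as ∷ _) len same with b ≤? a
... | no b≰a = ≰⇒> b≰a
... | yes b≤a = contradiction (begin-strict
      length (b ∷ bs)          ≡⟨ len ⟨
      length as                ≡⟨ count≥-all a<as ⟨
      count≥ (suc a) as        ≡⟨ count≥-reject as ≤-refl ⟨
      count≥ (suc a) (a ∷ as)  ≡⟨ same ⟨
      count≥ (suc a) (b ∷ bs)  ≡⟨ count≥-reject bs (s≤s b≤a) ⟩
      count≥ (suc a) bs        ≤⟨ count≥≤length (suc a) bs ⟩
      length bs                <⟨ n<1+n _ ⟩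
      length (b ∷ bs)          ∎) (<-irrefl refl)
  where open ≤-Reasoning

firstFail-head≤ : ∀ {a as b bs} → Sorted (b ∷ bs) → AllPairs _<_ (a ∷ as) → length as ≡ length (b ∷ bs) →
  count≥ (suc a) (b ∷ bs) < count≥ (suc a) (a ∷ as) → b ≤ a
firstFail-head≤ {a} {as} {b} {bs} sbs (a<as ∷ _) len fewer =
  ≤-pred (Sorted-head< sbs (count≥<length⇒Any (suc a) (b ∷ bs) (begin-strict
    count≥ (suc a) (b ∷ bs)  <⟨ fewer ⟩
    count≥ (suc a) (a ∷ as)  ≡⟨ count≥-reject as ≤-refl ⟩
    count≥ (suc a) as        ≡⟨ count≥-all a<as ⟩
    length as                ≡⟨ len ⟩
    length (b ∷ bs)          ∎)))
  where open ≤-Reasoning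

firstFail-∷ : ∀ {a as b bs} → b ≤ a → firstFail (b ∷ bs) (a ∷ as) ≡ firstFail bs as
firstFail-∷ b≤a rewrite ≤ᵇ-true b≤a = refl

firstFail-≡ : ∀ {m} bs as → Sorted bs → AllPairs _<_ as → length as ≡ suc (length bs) → m ∈ as →
  (∀ x → m < x → count≥ x bs ≡ count≥ x as) →
  (∀ x → x ≤ m → count≥ x bs < count≥ x as) →
  firstFail bs as ≡ just m
firstFail-≡ []       (a ∷ [])     _ _ _ (here refl) _ _ = refl
firstFail-≡ []       (a ∷ _ ∷ _)  _ _ () _ _ _
firstFail-≡ (b ∷ bs) (a ∷ as) _ sas len (here refl) above _
  rewrite ≤ᵇ-false (firstFail-head< {b = b} {bs} sas (suc-injective len) (above (suc a) ≤-refl)) = refl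
firstFail-≡ {m} (b ∷ bs) (a ∷ as) sbs@(_ ∷ sbs′) (a<as ∷ sas) len (there m∈as) above atOrBelow
  = trans (firstFail-∷ {as = as} {bs = bs} b≤a) (firstFail-≡ bs as sbs′ sas (suc-injective len) m∈as above′ atOrBelow′)
  where
    open ≤-Reasoning
    a<m : a < m
    a<m = All.lookup a<as m∈as
    b≤a : b ≤ a
    b≤a = firstFail-head≤ sbs (a<as ∷ sas) (suc-injective len) (atOrBelow (suc a) a<m)
    above′ : ∀ x → m < x → count≥ x bs ≡ count≥ x as
    above′ x m<x = begin-equality
      count≥ x bs       ≡⟨ count≥-reject bs (≤-<-trans b≤a a<x) ⟨
      count≥ x (b ∷ bs) ≡⟨ above x m<x ⟩
      count≥ x (a ∷ as) ≡⟨ count≥-reject as a<x ⟩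
      count≥ x as       ∎
      where a<x = <-trans a<m m<x
    atOrBelow′ : ∀ x → x ≤ m → count≥ x bs < count≥ x as
    atOrBelow′ x x≤m with x ≤? b | x ≤? a
    ... | yes x≤b | _ = +-cancelˡ-< 1 _ _ (begin-strict
      suc (count≥ x bs)  ≡⟨ count≥-accept bs x≤b ⟨
      count≥ x (b ∷ bs)  <⟨ atOrBelow x x≤m ⟩
      count≥ x (a ∷ as)  ≡⟨ count≥-accept as (≤-trans x≤b b≤a) ⟩
      suc (count≥ x as)  ∎)
    ... | no x≰b | yes x≤a = begin-strict
      count≥ x bs        ≤⟨ count≥≤length x bs ⟩
      length bs          <⟨ n<1+n _ ⟩
      suc (length bs)    ≡⟨ suc-injective len ⟨
      length as          ≡⟨ count≥-all (All.map (≤-trans x≤a ∘ <⇒≤) a<as) ⟨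
      count≥ x as        ∎
    ... | no x≰b | no x≰a = begin-strict
      count≥ x bs        ≡⟨ count≥-reject bs (≰⇒> x≰b) ⟨
      count≥ x (b ∷ bs)  <⟨ atOrBelow x x≤m ⟩
      count≥ x (a ∷ as)  ≡⟨ count≥-reject as (≰⇒> x≰a) ⟩
      count≥ x as        ∎

data MaxBelow (b : ℕ) (xs : List ℕ) : Maybe ℕ → Set where
  none : All (b <_) xs → MaxBelow b xs nothing
  some : ∀ {c} → c ∈ xs → c ≤ b → (∀ {y} → y ∈ xs → y ≤ b → y ≤ c) → MaxBelow b xs (just c)

maxBelow-view : ∀ b xs → MaxBelow b xs (maxBelow b xs)
maxBelow-view b [] = none []
maxBelow-view b (x ∷ xs) with maxBelow b xs | maxBelow-view b xs
... | nothing | none b<xs with x ≤ᵇ b | ≤ᵇ-reflects-≤ x b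
...   | true  | ofʸ x≤b = some (here refl) x≤b λ
        { (here refl) _ → ≤-refl
        ; (there y∈xs) y≤b → contradiction y≤b (<⇒≱ (All.lookup b<xs y∈xs)) }
...   | false | ofⁿ x≰b = none (≰⇒> x≰b ∷ b<xs)
maxBelow-view b (x ∷ xs) | just c | some c∈xs c≤b max with x ≤ᵇ b | ≤ᵇ-reflects-≤ x b
... | false | ofⁿ x≰b = some (there c∈xs) c≤b λ
        { (here refl) x≤b → contradiction x≤b x≰b
        ; (there y∈xs) → max y∈xs }
... | true  | ofʸ x≤b with c ≤ᵇ x | ≤ᵇ-reflects-≤ c x
...   | true  | ofʸ c≤x = some (here refl) x≤b λ
        { (here refl) _ → ≤-refl
        ; (there y∈xs) y≤b → ≤-trans (max y∈xs y≤b) c≤x }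
...   | false | ofⁿ c≰x = some (there c∈xs) c≤b λ
        { (here refl) _ → <⇒≤ (≰⇒> c≰x)
        ; (there y∈xs) → max y∈xs }

last-∈ : ∀ x xs → Σ ℕ λ l → last (x ∷ xs) ≡ just l × l ∈ x ∷ xs
last-∈ x [] = x , refl , here refl
last-∈ x (y ∷ ys) with last-∈ y ys
... | l , last≡l , l∈ = l , last≡l , there l∈

maxBelow-last : ∀ b xs → AllPairs _<_ xs → All (_≤ b) xs → maxBelow b xs ≡ last xs
maxBelow-last b [] _ _ = refl
maxBelow-last b (x ∷ []) _ (x≤b ∷ _) rewrite ≤ᵇ-true x≤b = refl
maxBelow-last b (x ∷ y ∷ ys) (x<ys ∷ sorted) (x≤b ∷ ≤b) with last-∈ y ys
... | l , last≡l , l∈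
  rewrite maxBelow-last b (y ∷ ys) sorted ≤b | last≡l | ≤ᵇ-true x≤b | ≤ᵇ-false (All.lookup x<ys l∈) = refl

remove-↭ : ∀ {x xs} → x ∈ xs → x ∷ remove x xs ↭ xs
remove-↭ {x} {y ∷ ys} x∈ with x ≡ᵇ y | ≡ᵇ-reflects-≡ x y | x∈
... | true  | ofʸ refl | _          = ↭-refl
... | false | ofⁿ x≢y  | here x≡y   = contradiction x≡y x≢y
... | false | ofⁿ _    | there x∈ys = ↭-trans (swap x y ↭-refl) (prep y (remove-↭ x∈ys))

length-remove : ∀ {x xs} → x ∈ xs → suc (length (remove x xs)) ≡ length xs
length-remove x∈ = ↭-length (remove-↭ x∈)

All-remove⁺ : ∀ {P : ℕ → Set} x {xs} → All P xs → All P (remove x xs)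
All-remove⁺ x [] = []
All-remove⁺ x {y ∷ ys} (py ∷ pys) with x ≡ᵇ y
... | true  = pys
... | false = py ∷ All-remove⁺ x pys

AllPairs-remove⁺ : ∀ {R : ℕ → ℕ → Set} x {xs} → AllPairs R xs → AllPairs R (remove x xs)
AllPairs-remove⁺ x [] = []
AllPairs-remove⁺ x {y ∷ ys} (ry ∷ rys) with x ≡ᵇ y
... | true  = rys
... | false = All-remove⁺ x ry ∷ AllPairs-remove⁺ x rys

elem-reflects-∈ : ∀ x xs → Reflects (x ∈ xs) (elem x xs)
elem-reflects-∈ x [] = ofⁿ λ ()
elem-reflects-∈ x (y ∷ ys) with x ≡ᵇ y | ≡ᵇ-reflects-≡ x y
... | true  | ofʸ x≡y = ofʸ (here x≡y)
... | false | ofⁿ x≢y with elem x ys | elem-reflects-∈ x ys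
...   | true  | ofʸ x∈ys = ofʸ (there x∈ys)
...   | false | ofⁿ x∉ys = ofⁿ λ { (here x≡y) → x≢y x≡y ; (there x∈ys) → x∉ys x∈ys }

Unique-resp-↭ : ∀ {xs ys : List ℕ} → xs ↭ ys → Unique xs → Unique ys
Unique-resp-↭ ↭.refl u = u
Unique-resp-↭ (prep x p) (x∉ ∷ u) = All-resp-↭ p x∉ ∷ Unique-resp-↭ p u
Unique-resp-↭ (swap x y p) ((x≢y ∷ x∉) ∷ y∉ ∷ u) =
  (x≢y ∘ sym ∷ All-resp-↭ p y∉) ∷ All-resp-↭ p x∉ ∷ Unique-resp-↭ p u
Unique-resp-↭ (↭.trans p q) u =
  Unique-resp-↭ q (Unique-resp-↭ p u)

AllPairs-++⁻ˡ : ∀ {R : ℕ → ℕ → Set} xs {ys} → AllPairs R (xs ++ ys) → AllPairs R xs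
AllPairs-++⁻ˡ []       _            = []
AllPairs-++⁻ˡ (x ∷ xs) (rx ∷ rxs) = Allₚ.++⁻ˡ xs rx ∷ AllPairs-++⁻ˡ xs rxs

>⇒Unique : ∀ {xs} → AllPairs _>_ xs → Unique xs
>⇒Unique = AllPairs.map (λ y<x x≡y → <-irrefl (sym x≡y) y<x)

<⇒Unique : ∀ {xs} → AllPairs _<_ xs → Unique xs
<⇒Unique = AllPairs.map <⇒≢

-- The first phase of the maximal lift

≼-∷⇒Any< : ∀ {C w W} → C ≼ (w ∷ W) → Any (_< suc w) C
≼-∷⇒Any< {C} {w} {W} (len , cnt) = count≥<length⇒Any (suc w) C (begin-strict
  count≥ (suc w) C        ≤⟨ cnt (suc w) ⟩
  count≥ (suc w) (w ∷ W)  ≡⟨ count≥-reject W ≤-refl ⟩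
  count≥ (suc w) W        ≤⟨ count≥≤length (suc w) W ⟩
  length W                <⟨ n<1+n _ ⟩
  length (w ∷ W)          ≡⟨ len ⟨
  length C                ∎)
  where open ≤-Reasoning

≼-∷⇒All≤ : ∀ {C w W} → C ≼ (w ∷ W) → All (_≤ w) W → All (_≤ w) C
≼-∷⇒All≤ {C} {w} {W} (_ , cnt) W≤w = All.map ≤-pred (count≥≡0⇒All (suc w) C (n≤0⇒n≡0 (begin
  count≥ (suc w) C        ≤⟨ cnt (suc w) ⟩
  count≥ (suc w) (w ∷ W)  ≡⟨ count≥-reject W ≤-refl ⟩
  count≥ (suc w) W        ≡⟨ count≥-none (All.map s≤s W≤w) ⟩
  0                       ∎)))
  where open ≤-Reasoning

≼-remove-maxBelow : ∀ {C c w W} → c ∈ C → c ≤ w → (∀ {y} → y ∈ C → y ≤ w → y ≤ c) →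
  C ≼ (w ∷ W) → remove c C ≼ W
≼-remove-maxBelow {C} {c} {w} {W} c∈C c≤w max (len , cnt) =
  suc-injective (trans (length-remove c∈C) len) , bound
  where
    open ≤-Reasoning
    bound : ∀ x → count≥ x (remove c C) ≤ count≥ x W
    bound x with x ≤? c | x ≤? w
    ... | yes x≤c | _ = +-cancelˡ-≤ 1 _ _ (begin
      suc (count≥ x (remove c C))  ≡⟨ count≥-accept (remove c C) x≤c ⟨
      count≥ x (c ∷ remove c C)    ≡⟨ count≥-↭ x (remove-↭ c∈C) ⟩
      count≥ x C                   ≤⟨ cnt x ⟩
      count≥ x (w ∷ W)             ≡⟨ count≥-accept W (≤-trans x≤c c≤w) ⟩
      suc (count≥ x W)             ∎)
    ... | no x≰c | no x≰w = begin
      count≥ x (remove c C)        ≡⟨ count≥-reject (remove c C) (≰⇒> x≰c) ⟨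
      count≥ x (c ∷ remove c C)    ≡⟨ count≥-↭ x (remove-↭ c∈C) ⟩
      count≥ x C                   ≤⟨ cnt x ⟩
      count≥ x (w ∷ W)             ≡⟨ count≥-reject W (≰⇒> x≰w) ⟩
      count≥ x W                   ∎
    ... | no x≰c | yes x≤w = begin
      count≥ x (remove c C)        ≡⟨ count≥-reject (remove c C) (≰⇒> x≰c) ⟨
      count≥ x (c ∷ remove c C)    ≡⟨ count≥-↭ x (remove-↭ c∈C) ⟩
      count≥ x C                   ≤⟨ count≥-mono C above-w ⟩
      count≥ (suc w) C             ≤⟨ cnt (suc w) ⟩
      count≥ (suc w) (w ∷ W)       ≡⟨ count≥-reject W ≤-refl ⟩
      count≥ (suc w) W             ≤⟨ count≥-mono W (λ _ → ≤-trans (m≤n⇒m≤1+n x≤w)) ⟩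
      count≥ x W                   ∎
      where
        above-w : ∀ {y} → y ∈ C → x ≤ y → suc w ≤ y
        above-w {y} y∈C x≤y with y ≤? w
        ... | yes y≤w = contradiction (≤-trans x≤y (max y∈C y≤w)) x≰c
        ... | no y≰w = ≰⇒> y≰w

maxBelow-≼ : ∀ C w W → C ≼ (w ∷ W) →
  Σ ℕ λ c → maxBelow w C ≡ just c × c ∈ C × remove c C ≼ W
maxBelow-≼ C w W C≼wW with maxBelow w C | maxBelow-view w C
... | nothing | none w<C =
  ⊥-elim (All.lookupWith (λ w<y y<1+w → <⇒≱ w<y (≤-pred y<1+w)) w<C (≼-∷⇒Any< C≼wW))
... | just c  | some c∈C c≤w max = c , refl , c∈C , ≼-remove-maxBelow c∈C c≤w max C≼wW

data LineRun : List (List ℕ) → List ℕ → List (List ℕ) → Set where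
  []  : ∀ {T} → LineRun T [] T
  _∷_ : ∀ {T v T′ vs T″} → wT T ≡ just (v , T′) → LineRun T′ vs T″ → LineRun T (v ∷ vs) T″

LineRun⇒lineIter : ∀ {T vs T′} → LineRun T vs T′ → lineIter (length vs) T ≡ just vs
LineRun⇒lineIter [] = refl
LineRun⇒lineIter (wT≡ ∷ run) rewrite wT≡ | LineRun⇒lineIter run = refl

LineRun-[] : ∀ {T T′} → LineRun T [] T′ → T ≡ T′
LineRun-[] [] = refl

wT-just⁻ : ∀ T {v T′} → wT T ≡ just (v , T′) →
  Σ (List (List ℕ)) λ T₀ → lineStep T ≡ just (v , T₀) × nonemptyCols T₀ ≡ T′
wT-just⁻ T wT≡ with lineStep T | wT≡
... | just (v , T₀) | refl = T₀ , refl , refl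

wT-∷ : ∀ C T {v′ T₀ v} → lineStep T ≡ just (v′ , T₀) → maxBelow v′ C ≡ just v →
  wT (C ∷ T) ≡ just (v , nonemptyCols (remove v C ∷ T₀))
wT-∷ C (_ ∷ _) step≡ maxBelow≡ rewrite step≡ | maxBelow≡ = refl

wT-[-] : ∀ C {v} → last C ≡ just v → wT (C ∷ []) ≡ just (v , nonemptyCols (remove v C ∷ []))
wT-[-] C last≡ rewrite last≡ = refl

-- The line through R that ends at the letter w of u meets C in maxBelow w C,
-- the greedy choice of the first phase.  Once R is used up, the line starts at
-- the bottom of C, which is maxBelow x C because x bounds all of C.
liftFirst-LineRun : ∀ C R u X → AllPairs _<_ C → LineRun (nonemptyCols R) u [] →
  AllPairs _>_ X → C ≼ (u ++ X) →
  Σ (List ℕ) λ σ → LineRun (nonemptyCols (C ∷ R)) σ [] × liftFirst C (u ++ X) ≡ just σ × σ ↭ C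
liftFirst-LineRun [] R [] [] _ run _ _ = [] , run , refl , ↭-refl
liftFirst-LineRun [] R (_ ∷ _) _ _ _ _ (() , _)
liftFirst-LineRun [] R [] (_ ∷ _) _ _ _ (() , _)
liftFirst-LineRun C@(_ ∷ _) R [] [] _ _ _ (() , _)
liftFirst-LineRun C@(_ ∷ _) R (v ∷ u) X sC (wT≡ ∷ run) sX C≼
  with wT-just⁻ (nonemptyCols R) wT≡ | maxBelow-≼ C v (u ++ X) C≼
... | R₀ , step≡ , refl | c , maxBelow≡ , c∈C , rest≼
  with liftFirst-LineRun (remove c C) R₀ u X (AllPairs-remove⁺ c sC) run sX rest≼
... | σ , run′ , liftFirst≡ , σ↭ =
  c ∷ σ , wT-∷ C (nonemptyCols R) step≡ maxBelow≡ ∷ run′ , lf , ↭-trans (prep c σ↭) (remove-↭ c∈C)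
  where
    lf : liftFirst C (v ∷ u ++ X) ≡ just (c ∷ σ)
    lf rewrite maxBelow≡ | liftFirst≡ = refl
liftFirst-LineRun C@(c₀ ∷ cs) R [] (x ∷ X) sC run (x>X ∷ sX) C≼
  with maxBelow-≼ C x X C≼ | last-∈ c₀ cs | LineRun-[] run
... | c , maxBelow≡ , c∈C , rest≼ | l , last≡ , _ | R-empty
  with trans (sym maxBelow≡) (trans (maxBelow-last x C sC (≼-∷⇒All≤ C≼ (All.map <⇒≤ x>X))) last≡)
... | refl with liftFirst-LineRun (remove c C) [] [] X (AllPairs-remove⁺ c sC) [] sX rest≼
... | σ , run′ , liftFirst≡ , σ↭ =
  c ∷ σ , subst (λ T → LineRun (C ∷ T) (c ∷ σ) []) (sym R-empty) (wT-[-] C last≡ ∷ run′) ,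
  lf , ↭-trans (prep c σ↭) (remove-↭ c∈C)
  where
    lf : liftFirst C (x ∷ X) ≡ just (c ∷ σ)
    lf rewrite maxBelow≡ | liftFirst≡ = refl

-- Complements

elem-false : ∀ {x xs} → x ∉ xs → elem x xs ≡ false
elem-false {x} {xs} x∉xs = det (elem-reflects-∈ x xs) (ofⁿ x∉xs)

elem-cong : ∀ {x A B} → (x ∈ A → x ∈ B) → (x ∈ B → x ∈ A) → elem x A ≡ elem x B
elem-cong {x} {A} {B} to from with elem x A | elem-reflects-∈ x A | elem x B | elem-reflects-∈ x B
... | true  | _       | true  | _       = refl
... | false | _       | false | _       = refl
... | true  | ofʸ x∈A | false | ofⁿ x∉B = contradiction (to x∈A) x∉B
... | false | ofⁿ x∉A | true  | ofʸ x∈B = contradiction (from x∈B) x∉A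

complement : List ℕ → List ℕ → List ℕ
complement B = filterᵇ (λ x → not (elem x B))

complement-∷-∈ : ∀ B {y} L → y ∈ B → complement B (y ∷ L) ≡ complement B L
complement-∷-∈ B {y} L y∈B with elem y B | elem-reflects-∈ y B
... | true  | _       = refl
... | false | ofⁿ y∉B = contradiction y∈B y∉B

complement-∷-∉ : ∀ B {y} L → y ∉ B → complement B (y ∷ L) ≡ y ∷ complement B L
complement-∷-∉ B {y} L y∉B with elem y B | elem-reflects-∈ y B
... | false | _       = refl
... | true  | ofʸ y∈B = contradiction y∈B y∉B

filterᵇ-cong : ∀ (p q : ℕ → Bool) xs → (∀ {x} → x ∈ xs → p x ≡ q x) → filterᵇ p xs ≡ filterᵇ q xs
filterᵇ-cong p q [] _ = refl
filterᵇ-cong p q (y ∷ ys) p≡q with p y | q y | p≡q (here refl)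
... | true  | .true  | refl = cong (y ∷_) (filterᵇ-cong p q ys (p≡q ∘ there))
... | false | .false | refl = filterᵇ-cong p q ys (p≡q ∘ there)

complement-cong : ∀ {B B′} L → (∀ {x} → x ∈ L → x ∈ B → x ∈ B′) → (∀ {x} → x ∈ L → x ∈ B′ → x ∈ B) →
  complement B L ≡ complement B′ L
complement-cong L to from = filterᵇ-cong _ _ L λ x∈L → cong not (elem-cong (to x∈L) (from x∈L))

complement-↭ : ∀ {B B′} L → B ↭ B′ → complement B L ≡ complement B′ L
complement-↭ L B↭B′ = complement-cong L (λ _ → ∈-resp-↭ B↭B′) (λ _ → ∈-resp-↭ (↭-sym B↭B′))

complement-∷ˡ : ∀ {m} B L → m ∉ L → complement (m ∷ B) L ≡ complement B L
complement-∷ˡ B L m∉L = complement-cong L to (λ _ → there)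
  where
    to : ∀ {x} → x ∈ L → x ∈ _ ∷ B → x ∈ B
    to x∈L (here refl) = contradiction x∈L m∉L
    to _   (there x∈B) = x∈B

complement-remove : ∀ {y} B L → Unique B → y ∈ B → y ∉ L → complement (remove y B) L ≡ complement B L
complement-remove {y} B L uB y∈B y∉L = complement-cong L (λ _ → ∈-resp-↭ (remove-↭ y∈B) ∘ there) from
  where
    from : ∀ {x} → x ∈ L → x ∈ B → x ∈ remove y B
    from x∈L x∈B with ∈-resp-↭ (↭-sym (remove-↭ y∈B)) x∈B
    ... | here refl = contradiction x∈L y∉L
    ... | there x∈B′ = x∈B′

complement-head : ∀ {m Z} B L → Unique L → complement B L ≡ m ∷ Z → complement (m ∷ B) L ≡ Z
complement-head {m} B (y ∷ L) uyL@(_ ∷ uL) compl≡ with y ∈? B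
... | yes y∈B = trans (complement-∷-∈ (m ∷ B) L (there y∈B))
                      (complement-head B L uL (trans (sym (complement-∷-∈ B L y∈B)) compl≡))
... | no y∉B with trans (sym (complement-∷-∉ B L y∉B)) compl≡
...   | refl = trans (complement-∷-∈ (y ∷ B) L (here refl)) (complement-∷ˡ B L (Unique[x∷xs]⇒x∉xs uyL))

complement-++-↭ : ∀ B L → Unique L → Unique B → B ⊆ L → B ++ complement B L ↭ L
complement-++-↭ []      [] _ _ _   = ↭-refl
complement-++-↭ (b ∷ B) [] _ _ B⊆L = contradiction (B⊆L (here refl)) λ ()
complement-++-↭ B (y ∷ L) uyL@(_ ∷ uL) uB B⊆yL with y ∈? B
... | yes y∈B = begin
  B ++ complement B (y ∷ L)                     ≡⟨ cong (B ++_) (complement-∷-∈ B L y∈B) ⟩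
  B ++ complement B L                           ≡⟨ cong (B ++_) (complement-remove B L uB y∈B y∉L) ⟨
  B ++ complement (remove y B) L                ↭⟨ ++⁺ʳ _ (remove-↭ y∈B) ⟨
  y ∷ (remove y B ++ complement (remove y B) L) <⟨ complement-++-↭ (remove y B) L uL (AllPairs-remove⁺ y uB) B′⊆L ⟩
  y ∷ L                                         ∎
  where
    open PermutationReasoning
    y∉L = Unique[x∷xs]⇒x∉xs uyL
    B′⊆L : remove y B ⊆ L
    B′⊆L b∈B′ with B⊆yL (∈-resp-↭ (remove-↭ y∈B) (there b∈B′))
    ... | there b∈L = b∈L
    ... | here refl = contradiction b∈B′ (Unique[x∷xs]⇒x∉xs (Unique-resp-↭ (↭-sym (remove-↭ y∈B)) uB))
... | no y∉B = begin
  B ++ complement B (y ∷ L)   ≡⟨ cong (B ++_) (complement-∷-∉ B L y∉B) ⟩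
  B ++ (y ∷ complement B L)   ↭⟨ shift y B _ ⟩
  y ∷ (B ++ complement B L)   <⟨ complement-++-↭ B L uL uB B⊆L ⟩
  y ∷ L                       ∎
  where
    open PermutationReasoning
    B⊆L : B ⊆ L
    B⊆L b∈B with B⊆yL b∈B
    ... | there b∈L = b∈L
    ... | here refl = contradiction b∈B y∉B

-- The second phase of the maximal lift

-- L is split as A followed by the unread letters γ ∷ ws of the word, and as B
-- followed by its complement m ∷ Z.  While B ≼ A, the sub-procedure P outputs
-- m, the largest value not in B.
module _ {L A B ws Z : List ℕ} {γ m : ℕ}
         (L-dec : AllPairs _>_ L) (A-split : A ++ γ ∷ ws ↭ L) (B-split : B ++ m ∷ Z ↭ L)
         (γws-dec : AllPairs _>_ (γ ∷ ws)) (mZ-dec : AllPairs _>_ (m ∷ Z)) (B≼A : B ≼ A) where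

  private
    open ≤-Reasoning

    count-A : ∀ x → count≥ x A + count≥ x (γ ∷ ws) ≡ count≥ x L
    count-A x = count≥-split x A (γ ∷ ws) A-split

    count-B : ∀ x → count≥ x B + count≥ x (m ∷ Z) ≡ count≥ x L
    count-B x = count≥-split x B (m ∷ Z) B-split

    γ∷A++ws-unique : Unique (γ ∷ A ++ ws)
    γ∷A++ws-unique = Unique-resp-↭ (↭-trans (↭-sym A-split) (shift γ A ws)) (>⇒Unique L-dec)

  γ≤m : γ ≤ m
  γ≤m with γ ≤? m
  ... | yes γ≤m = γ≤m
  ... | no γ≰m = contradiction (begin-strict
    count≥ γ L                             ≡⟨ count-B γ ⟨
    count≥ γ B + count≥ γ (m ∷ Z)          ≡⟨ cong (count≥ γ B +_) (dec-head<⇒count≥≡0 mZ-dec (≰⇒> γ≰m)) ⟩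
    count≥ γ B + 0                         ≡⟨ +-identityʳ _ ⟩
    count≥ γ B                             ≤⟨ proj₂ B≼A γ ⟩
    count≥ γ A                             <⟨ m<m+n _ (subst (0 <_) (sym (count≥-accept ws (≤-refl {γ}))) z<s) ⟩
    count≥ γ A + count≥ γ (γ ∷ ws)         ≡⟨ count-A γ ⟩
    count≥ γ L                             ∎) (<-irrefl refl)

  m∈γ∷A : m ∈ γ ∷ A
  m∈γ∷A with ∈-++⁻ A (∈-resp-↭ (↭-trans B-split (↭-sym A-split)) (∈-++⁺ʳ B (here refl)))
  ... | inj₁ m∈A         = there m∈A
  ... | inj₂ (here m≡γ)  = here m≡γ
  ... | inj₂ (there m∈ws) = contradiction γ≤m (<⇒≱ (All.lookup (AllPairs.head γws-dec) m∈ws))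

  γ∉A : γ ∉ A
  γ∉A = Unique[x∷xs]⇒x∉xs γ∷A++ws-unique ∘ ∈-++⁺ˡ

  count-above : ∀ x → m < x → count≥ x B ≡ count≥ x (γ ∷ A)
  count-above x m<x = begin-equality
    count≥ x B                      ≡⟨ +-identityʳ _ ⟨
    count≥ x B + 0                  ≡⟨ cong (count≥ x B +_) (dec-head<⇒count≥≡0 mZ-dec m<x) ⟨
    count≥ x B + count≥ x (m ∷ Z)   ≡⟨ count-B x ⟩
    count≥ x L                      ≡⟨ count-A x ⟨
    count≥ x A + count≥ x (γ ∷ ws)  ≡⟨ cong (count≥ x A +_) (dec-head<⇒count≥≡0 γws-dec γ<x) ⟩
    count≥ x A + 0                  ≡⟨ +-identityʳ _ ⟩
    count≥ x A                      ≡⟨ count≥-reject A γ<x ⟨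
    count≥ x (γ ∷ A)                ∎
    where γ<x = ≤-<-trans γ≤m m<x

  count-atOrBelow : ∀ x → x ≤ m → count≥ x B < count≥ x (γ ∷ A)
  count-atOrBelow x x≤m with x ≤? γ
  ... | yes x≤γ rewrite count≥-accept A x≤γ = s≤s (proj₂ B≼A x)
  ... | no x≰γ = begin-strict
    count≥ x B                      <⟨ m<m+n _ (subst (0 <_) (sym (count≥-accept Z x≤m)) z<s) ⟩
    count≥ x B + count≥ x (m ∷ Z)   ≡⟨ count-B x ⟩
    count≥ x L                      ≡⟨ count-A x ⟨
    count≥ x A + count≥ x (γ ∷ ws)  ≡⟨ cong (count≥ x A +_) (dec-head<⇒count≥≡0 γws-dec (≰⇒> x≰γ)) ⟩
    count≥ x A + 0                  ≡⟨ +-identityʳ _ ⟩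
    count≥ x A                      ≡⟨ count≥-reject A (≰⇒> x≰γ) ⟨
    count≥ x (γ ∷ A)                ∎

  ∷≼∷ : (m ∷ B) ≼ (γ ∷ A)
  ∷≼∷ = cong suc (proj₁ B≼A) , bound
    where
      bound : ∀ x → count≥ x (m ∷ B) ≤ count≥ x (γ ∷ A)
      bound x with x ≤? m
      ... | yes x≤m rewrite count≥-accept B x≤m = count-atOrBelow x x≤m
      ... | no x≰m rewrite count≥-reject B (≰⇒> x≰m) = ≤-reflexive (count-above x (≰⇒> x≰m))

  firstFail-sort-≡ : firstFail (sort B) (sort (γ ∷ A)) ≡ just m
  firstFail-sort-≡ = firstFail-≡ (sort B) (sort (γ ∷ A)) (sort-sorted B)
    (AllPairs.zipWith (λ (y≤z , y≢z) → ≤∧≢⇒< y≤z y≢z)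
      (sort-sorted (γ ∷ A) , Unique-resp-↭ (↭-sym sort-γ∷A) (AllPairs-++⁻ˡ (γ ∷ A) γ∷A++ws-unique)))
    (trans (↭-length sort-γ∷A) (cong suc (trans (sym (proj₁ B≼A)) (sym (↭-length (sort-↭ B))))))
    (∈-resp-↭ (↭-sym sort-γ∷A) m∈γ∷A)
    (λ x m<x → trans (count≥-↭ x (sort-↭ B)) (trans (count-above x m<x) (sym (count≥-↭ x sort-γ∷A))))
    (λ x x≤m → subst₂ _<_ (sym (count≥-↭ x (sort-↭ B))) (sym (count≥-↭ x sort-γ∷A)) (count-atOrBelow x x≤m))
    where sort-γ∷A = sort-↭ (γ ∷ A)

  procP-≡ : procP A B γ ≡ just (m , γ ∷ A , m ∷ B)
  procP-≡ rewrite elem-false γ∉A | ≼⇒leqSet B A B≼A | firstFail-sort-≡ = refl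

length-++-↭-cancel : ∀ (A ws B Z : List ℕ) {L : List ℕ} → A ++ ws ↭ L → B ++ Z ↭ L → length B ≡ length A →
  length Z ≡ length ws
length-++-↭-cancel A ws B Z {L} A-split B-split len = +-cancelˡ-≡ (length B) _ _ (begin
  length B + length Z    ≡⟨ length-split B Z B-split ⟩
  length L               ≡⟨ length-split A ws A-split ⟨
  length A + length ws   ≡⟨ cong (_+ length ws) len ⟨
  length B + length ws   ∎)
  where open ≡-Reasoning

complement-dec : ∀ B {L} → AllPairs _>_ L → AllPairs _>_ (complement B L)
complement-dec B = AllPairs.filter⁺ _

liftSecond-∷ : ∀ A B γ ws {a A′ B′ rest} → procP A B γ ≡ just (a , A′ , B′) →
  liftSecond A′ B′ ws ≡ just rest → liftSecond A B (γ ∷ ws) ≡ just (a ∷ rest)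
liftSecond-∷ A B γ ws procP≡ next rewrite procP≡ | next = refl

liftSecond-complement : ∀ {L} A B ws → AllPairs _>_ L → A ++ ws ↭ L → B ++ complement B L ↭ L →
  AllPairs _>_ ws → B ≼ A → liftSecond A B ws ≡ just (complement B L)
liftSecond-complement {L} A B ws L-dec A-split B-split ws-dec B≼A with complement B L in compl≡
liftSecond-complement A B [] _ _ _ _ _ | [] = refl
liftSecond-complement A B [] _ A-split B-split _ B≼A | m ∷ Z =
  contradiction (length-++-↭-cancel A [] B (m ∷ Z) A-split B-split (proj₁ B≼A)) λ ()
liftSecond-complement A B (γ ∷ ws) _ A-split B-split _ B≼A | [] =
  contradiction (length-++-↭-cancel A (γ ∷ ws) B [] A-split B-split (proj₁ B≼A)) λ ()
liftSecond-complement {L} A B (γ ∷ ws) L-dec A-split B-split γws-dec B≼A | m ∷ Z =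
  liftSecond-∷ A B γ ws (procP-≡ L-dec A-split B-split γws-dec mZ-dec B≼A) next
  where
    mZ-dec : AllPairs _>_ (m ∷ Z)
    mZ-dec = subst (AllPairs _>_) compl≡ (complement-dec B L-dec)
    compl′≡ : complement (m ∷ B) L ≡ Z
    compl′≡ = complement-head B L (>⇒Unique L-dec) compl≡
    next : liftSecond (γ ∷ A) (m ∷ B) ws ≡ just Z
    next = trans
      (liftSecond-complement (γ ∷ A) (m ∷ B) ws L-dec (↭-trans (↭-sym (shift γ A ws)) A-split)
        (subst (λ Z′ → (m ∷ B) ++ Z′ ↭ L) (sym compl′≡) (↭-trans (↭-sym (shift m B Z)) B-split))
        (AllPairs.tail γws-dec) (∷≼∷ L-dec A-split B-split γws-dec mZ-dec B≼A))
      (cong just compl′≡)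

-- The induction over columns

take++drop : ∀ k (xs : List ℕ) → take k xs ++ drop k xs ≡ xs
take++drop zero    xs       = refl
take++drop (suc k) []       = refl
take++drop (suc k) (x ∷ xs) = cong (x ∷_) (take++drop k xs)

take-++ : ∀ (xs ys : List ℕ) k → take (length xs + k) (xs ++ ys) ≡ xs ++ take k ys
take-++ []       ys k = refl
take-++ (x ∷ xs) ys k = cong (x ∷_) (take-++ xs ys k)

drop-++ : ∀ (xs ys : List ℕ) k → drop (length xs + k) (xs ++ ys) ≡ drop k ys
drop-++ []       ys k = refl
drop-++ (x ∷ xs) ys k = drop-++ xs ys k

length-take : ∀ k (xs : List ℕ) → k ≤ length xs → length (take k xs) ≡ k
length-take zero    xs       _         = refl
length-take (suc k) (x ∷ xs) (s≤s k≤) = cong suc (length-take k xs k≤)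

All-take⁺ : ∀ {P : ℕ → Set} k {xs} → All P xs → All P (take k xs)
All-take⁺ zero    _          = []
All-take⁺ (suc k) []         = []
All-take⁺ (suc k) (px ∷ pxs) = px ∷ All-take⁺ k pxs

AllPairs-take⁺ : ∀ {R : ℕ → ℕ → Set} k {xs} → AllPairs R xs → AllPairs R (take k xs)
AllPairs-take⁺ zero    _          = []
AllPairs-take⁺ (suc k) []         = []
AllPairs-take⁺ (suc k) (rx ∷ rxs) = All-take⁺ k rx ∷ AllPairs-take⁺ k rxs

AllPairs-drop⁺ : ∀ {R : ℕ → ℕ → Set} k {xs} → AllPairs R xs → AllPairs R (drop k xs)
AllPairs-drop⁺ zero    rxs        = rxs
AllPairs-drop⁺ (suc k) []         = []
AllPairs-drop⁺ (suc k) (_ ∷ rxs)  = AllPairs-drop⁺ k rxs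

count≥-take-dec : ∀ x k Z → AllPairs _>_ Z → count≥ x (take k Z) ≡ k ⊎ count≥ x (take k Z) ≡ count≥ x Z
count≥-take-dec x zero    Z       _ = inj₁ refl
count≥-take-dec x (suc k) []      _ = inj₂ refl
count≥-take-dec x (suc k) (z ∷ Z) zZ-dec@(_ ∷ Z-dec) with x ≤? z
... | yes x≤z rewrite count≥-accept (take k Z) x≤z | count≥-accept Z x≤z =
  Sum.map (cong suc) (cong suc) (count≥-take-dec x k Z Z-dec)
... | no x≰z = inj₂ (trans (dec-head<⇒count≥≡0 (AllPairs-take⁺ (suc k) zZ-dec) (≰⇒> x≰z))
                          (sym (dec-head<⇒count≥≡0 zZ-dec (≰⇒> x≰z))))

RowWeak-length : ∀ {C D} → RowWeak C D → length D ≤ length C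
RowWeak-length rw-[]       = z≤n
RowWeak-length (rw-∷ _ rw) = s≤s (RowWeak-length rw)

RowWeak-count≥ : ∀ x {C D} → RowWeak C D → count≥ x C ≤ count≥ x D + (length C ∸ length D)
RowWeak-count≥ x {C} rw-[] = count≥≤length x C
RowWeak-count≥ x {c ∷ C} {d ∷ D} (rw-∷ c≤d rw) with x ≤? c
... | yes x≤c rewrite count≥-accept C x≤c | count≥-accept D (≤-trans x≤c c≤d) = s≤s (RowWeak-count≥ x rw)
... | no x≰c rewrite count≥-reject C (≰⇒> x≰c) =
  ≤-trans (RowWeak-count≥ x rw) (+-monoˡ-≤ _ (count≥-∷ x d D))

-- Either the letters taken from complement t L include every value ≥ x of L,
-- or they are all ≥ x and row weakness bounds the count in C.
prefix-≼ : ∀ {L C D t} → AllPairs _>_ L → Unique C → C ⊆ L → Unique t → t ⊆ L →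
  RowWeak C D → t ↭ D → C ≼ (t ++ take (length C ∸ length t) (complement t L))
prefix-≼ {L} {C} {D} {t} L-dec uC C⊆L ut t⊆L rw t↭D = length-eq , bound
  where
    open ≤-Reasoning
    Z = complement t L
    r = length C ∸ length t
    t-split = complement-++-↭ t L (>⇒Unique L-dec) ut t⊆L
    C-split = complement-++-↭ C L (>⇒Unique L-dec) uC C⊆L
    t≤C : length t ≤ length C
    t≤C = subst (_≤ length C) (sym (↭-length t↭D)) (RowWeak-length rw)
    r≤Z : r ≤ length Z
    r≤Z = +-cancelˡ-≤ (length t) r (length Z) (begin
      length t + r                        ≡⟨ m+[n∸m]≡n t≤C ⟩
      length C                            ≤⟨ m≤m+n _ _ ⟩
      length C + length (complement C L)  ≡⟨ length-split C _ C-split ⟩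
      length L                            ≡⟨ length-split t Z t-split ⟨
      length t + length Z                 ∎)
    length-eq : length C ≡ length (t ++ take r Z)
    length-eq = sym (begin-equality
      length (t ++ take r Z)         ≡⟨ length-++ t ⟩
      length t + length (take r Z)   ≡⟨ cong (length t +_) (length-take r Z r≤Z) ⟩
      length t + r                   ≡⟨ m+[n∸m]≡n t≤C ⟩
      length C                       ∎)
    bound : ∀ x → count≥ x C ≤ count≥ x (t ++ take r Z)
    bound x with count≥-take-dec x r Z (complement-dec t L-dec)
    ... | inj₁ all-r = begin
      count≥ x C                          ≤⟨ RowWeak-count≥ x rw ⟩
      count≥ x D + (length C ∸ length D)  ≡⟨ cong₂ (λ a b → a + (length C ∸ b)) (count≥-↭ x t↭D) (↭-length t↭D) ⟨
      count≥ x t + r                      ≡⟨ cong (count≥ x t +_) all-r ⟨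
      count≥ x t + count≥ x (take r Z)    ≡⟨ count≥-++ x t _ ⟨
      count≥ x (t ++ take r Z)            ∎
    ... | inj₂ all-Z = begin
      count≥ x C                              ≤⟨ m≤m+n _ _ ⟩
      count≥ x C + count≥ x (complement C L)  ≡⟨ count≥-split x C _ C-split ⟩
      count≥ x L                              ≡⟨ count≥-split x t Z t-split ⟨
      count≥ x t + count≥ x Z                 ≡⟨ cong (count≥ x t +_) all-Z ⟨
      count≥ x t + count≥ x (take r Z)        ≡⟨ count≥-++ x t _ ⟨
      count≥ x (t ++ take r Z)                ∎

maxLift-≡ : ∀ p Y w {σ σ′} → leqSet Y (take p w) ≡ true → liftFirst Y (take p w) ≡ just σ →
  liftSecond (take p w) Y (drop p w) ≡ just σ′ → maxLift p Y w ≡ just (σ ++ σ′)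
maxLift-≡ p Y w leq first second rewrite leq | first | second = refl

maxLift-column : ∀ {L} C D R t → AllPairs _>_ L → AllPairs _<_ C → C ⊆ L → Unique t → t ⊆ L →
  RowWeak C D → t ↭ D → LineRun (nonemptyCols R) t [] →
  Σ (List ℕ) λ σ → LineRun (nonemptyCols (C ∷ R)) σ [] × σ ↭ C ×
    maxLift (length C) C (t ++ complement t L) ≡ just (σ ++ complement σ L)
maxLift-column {L} C D R t L-dec C-inc C⊆L ut t⊆L rw t↭D run
  with liftFirst-LineRun C R t (take (length C ∸ length t) (complement t L)) C-inc run
         (AllPairs-take⁺ _ (complement-dec t L-dec)) (prefix-≼ L-dec (<⇒Unique C-inc) C⊆L ut t⊆L rw t↭D)
... | σ , run′ , liftFirst≡ , σ↭C = σ , run′ , σ↭C ,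
  maxLift-≡ p C w (≼⇒leqSet C (take p w) C≼prefix) (trans (cong (liftFirst C) take≡) liftFirst≡)
    (trans second (cong just (complement-↭ L (↭-sym σ↭C))))
  where
    uC = <⇒Unique C-inc
    Z = complement t L
    p = length C
    r = length C ∸ length t
    w = t ++ Z
    q+r≡p : length t + r ≡ p
    q+r≡p = m+[n∸m]≡n (subst (_≤ p) (sym (↭-length t↭D)) (RowWeak-length rw))
    take≡ : take p w ≡ t ++ take r Z
    take≡ = trans (cong (λ k → take k w) (sym q+r≡p)) (take-++ t Z r)
    drop≡ : drop p w ≡ drop r Z
    drop≡ = trans (cong (λ k → drop k w) (sym q+r≡p)) (drop-++ t Z r)
    C≼prefix : C ≼ take p w
    C≼prefix = subst (C ≼_) (sym take≡) (prefix-≼ L-dec uC C⊆L ut t⊆L rw t↭D)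
    w-split : take p w ++ drop p w ↭ L
    w-split = subst (_↭ L) (sym (take++drop p w)) (complement-++-↭ t L (>⇒Unique L-dec) ut t⊆L)
    second : liftSecond (take p w) C (drop p w) ≡ just (complement C L)
    second = liftSecond-complement (take p w) C (drop p w) L-dec w-split
      (complement-++-↭ C L (>⇒Unique L-dec) uC C⊆L)
      (subst (AllPairs _>_) (sym drop≡) (AllPairs-drop⁺ r (complement-dec t L-dec))) C≼prefix

longest-range : ∀ n → All (λ x → 1 ≤ x × x ≤ n) (longest n)
longest-range zero    = []
longest-range (suc n) = (s≤s z≤n , ≤-refl) ∷ All.map (map₂ m≤n⇒m≤1+n) (longest-range n)

longest-dec : ∀ n → AllPairs _>_ (longest n)
longest-dec zero    = []
longest-dec (suc n) = All.map (s≤s ∘ proj₂) (longest-range n) ∷ longest-dec n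

∈-longest : ∀ {n x} → 1 ≤ x → x ≤ n → x ∈ longest n
∈-longest {zero}  1≤x x≤0 = contradiction (≤-trans 1≤x x≤0) λ ()
∈-longest {suc n} 1≤x x≤1+n with m≤n⇒m<n∨m≡n x≤1+n
... | inj₂ refl = here refl
... | inj₁ x<1+n = there (∈-longest 1≤x (≤-pred x<1+n))

complement-[] : ∀ L → complement [] L ≡ L
complement-[] [] = refl
complement-[] (x ∷ L) = cong (x ∷_) (complement-[] L)

nonemptyCols-id : ∀ S → All (_≢ []) S → nonemptyCols S ≡ S
nonemptyCols-id []             _          = refl
nonemptyCols-id ([] ∷ S)       (C≢[] ∷ _) = contradiction refl C≢[]
nonemptyCols-id ((x ∷ C) ∷ S)  (_ ∷ cols) = cong ((x ∷ C) ∷_) (nonemptyCols-id S cols)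

firstColumn : List (List ℕ) → List ℕ
firstColumn []      = []
firstColumn (C ∷ _) = C

IsSSYT-tail : ∀ {n C S} → IsSSYT n (C ∷ S) → IsSSYT n S
IsSSYT-tail ssyt = record
  { entries-in-[n] = All.tail entries-in-[n]
  ; cols-nonempty  = All.tail cols-nonempty
  ; cols-strict    = All.tail cols-strict
  ; rows-weak      = Linked.tail rows-weak
  }
  where open IsSSYT ssyt

column-⊆-longest : ∀ {n C} → All (λ x → 1 ≤ x × x ≤ n) C → C ⊆ longest n
column-⊆-longest range x∈C = let (1≤x , x≤n) = All.lookup range x∈C in ∈-longest 1≤x x≤n

firstColumn-All : ∀ {P : List ℕ → Set} S → P [] → All P S → P (firstColumn S)
firstColumn-All []      p[] _       = p[]
firstColumn-All (_ ∷ _) _   (p ∷ _) = p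

RowWeak-firstColumn : ∀ {C} S → Linked RowWeak (C ∷ S) → RowWeak C (firstColumn S)
RowWeak-firstColumn []      _        = rw-[]
RowWeak-firstColumn (_ ∷ _) (rw ∷ _) = rw

maxLift-firstColumn : ∀ {n C S t} → IsSSYT n (C ∷ S) → t ↭ firstColumn S → LineRun (nonemptyCols S) t [] →
  Σ (List ℕ) λ σ → LineRun (nonemptyCols (C ∷ S)) σ [] × σ ↭ C ×
    maxLift (length C) C (t ++ complement t (longest n)) ≡ just (σ ++ complement σ (longest n))
maxLift-firstColumn {n} {C} {S} {t} ssyt t↭D run =
  maxLift-column C (firstColumn S) S t (longest-dec n)
    (Linked⇒AllPairs <-trans (All.head cols-strict)) (column-⊆-longest (All.head entries-in-[n]))
    (Unique-resp-↭ (↭-sym t↭D) (<⇒Unique (Linked⇒AllPairs <-trans D-strict)))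
    (column-⊆-longest D-range ∘ ∈-resp-↭ t↭D) (RowWeak-firstColumn S rows-weak) t↭D run
  where
    open IsSSYT ssyt
    D-strict = firstColumn-All S [] (All.tail cols-strict)
    D-range  = firstColumn-All S [] (All.tail entries-in-[n])

liftChain-LineRun : ∀ n S → IsSSYT n S →
  Σ (List ℕ) λ t → LineRun (nonemptyCols S) t [] × t ↭ firstColumn S ×
    liftChain n S ≡ just (t ++ complement t (longest n))
liftChain-LineRun n [] _ = [] , [] , ↭-refl , cong just (sym (complement-[] (longest n)))
liftChain-LineRun n (C ∷ S) ssyt with liftChain-LineRun n S (IsSSYT-tail ssyt)
... | t , run , t↭D , chain≡ with maxLift-firstColumn ssyt t↭D run
... | σ , run′ , σ↭C , maxLift≡ = σ , run′ , σ↭C , trans (cong (_>>= maxLift (length C) C) chain≡) maxLift≡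

lineIter-firstColumn : ∀ {n S t} → IsSSYT n S → LineRun (nonemptyCols S) t [] → t ↭ firstColumn S →
  lineIter (firstColLength S) S ≡ just t
lineIter-firstColumn {S = S} {t} ssyt run t↭D =
  subst₂ (λ k T → lineIter k T ≡ just t) (trans (↭-length t↭D) (firstColLength≡ S))
    (nonemptyCols-id S (IsSSYT.cols-nonempty ssyt)) (LineRun⇒lineIter run)
  where
    firstColLength≡ : ∀ S → length (firstColumn S) ≡ firstColLength S
    firstColLength≡ []      = refl
    firstColLength≡ (_ ∷ _) = refl

proposition5p6 : (n : ℕ) (S : List (List ℕ)) → IsSSYT n S → S ≢ [] →
    Σ (List ℕ) (λ τ → (liftChain n S ≡ just τ) × (maxLine n S ≡ just τ))
proposition5p6 n S ssyt _ with liftChain-LineRun n S ssyt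
... | t , run , t↭D , liftChain≡ = t ++ complement t (longest n) , liftChain≡ , maxLine≡
  where
    maxLine≡ : maxLine n S ≡ just (t ++ complement t (longest n))
    maxLine≡ rewrite lineIter-firstColumn ssyt run t↭D = refl
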